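{- Let $\mathsf{X}$ be a strong nominal set, $x\in|\mathsf{X}|$, and $\pi,\gamma_1,\ldots,\gamma_n\in\mathrm{Perm}(\mathbb{A})$. If $\gamma_i\cdot x = x$ for every $i=1,\ldots,n$, and $\mathrm{dom}(\pi)\subseteq\bigcup_{1\le i\le n}\mathrm{dom}(\gamma_i)$, then $\pi\cdot x = x$.
   Context: Fix a countably infinite set $\mathbb{A}$ of atoms. A finite permutation is a bijection $\pi:\mathbb{A}\to\mathbb{A}$ with $\mathrm{dom}(\pi)=\{a\mid\pi(a)\neq a\}$ finite; they form the group $\mathrm{Perm}(\mathbb{A})$. A $\mathrm{Perm}(\mathbb{A})$-set is a set $|\mathsf{X}|$ with a group action of $\mathrm{Perm}(\mathbb{A})$. For $B\subseteq\mathbb{A}$, $\mathrm{Fix}(B)=\{\pi\mid\pi(b)=b\ \forall b\in B\}$. $B$ supports $x$ if $\pi\in\mathrm{Fix}(B)\Rightarrow\pi\cdot x=x$ for all $\pi$; $B$ strongly supports $x$ if $\pi\in\mathrm{Fix}(B)\Leftrightarrow\pi\cdot x=x$ for all $\pi$. A nominal set is a $\mathrm{Perm}(\mathbb{A})$-set all of whose elements have a finite support; it is strong if every element is strongly supported by some finite set. -}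

module Defs where

open import Level using (Level; suc; _⊔_)
open import Data.Nat using (ℕ)
open import Data.List using (List)
open import Data.List.Membership.Propositional using (_∈_)
open import Data.Product using (Σ; ∃; _×_)
open import Relation.Binary.PropositionalEquality using (_≡_; _≢_)

Atom : Set
Atom = ℕ

-- A finite permutation of the atoms: a bijection with finite domain
-- dom(π) = { a | π a ≠ a }.
record Perm : Set where
  field
    to      : Atom → Atom
    from    : Atom → Atom
    to-from : ∀ a → to (from a) ≡ a
    from-to : ∀ a → from (to a) ≡ a
    domList : List Atom
    dom-fin : ∀ a → to a ≢ a → a ∈ domList
open Perm public

InDom : Perm → Atom → Set
InDom π a = to π a ≢ a

-- Permutations are functions, so the action laws are phrased up to
-- pointwise equality of the underlying functions:
--   if ρ = π ∘ σ pointwise then ρ·x = π·(σ·x);   if π = id pointwise then π·x = x.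
record PermSet ℓ : Set (suc ℓ) where
  field
    Carrier : Set ℓ
    act     : Perm → Carrier → Carrier
    act-id  : ∀ (π : Perm) → (∀ a → to π a ≡ a) → ∀ x → act π x ≡ x
    act-∘   : ∀ (π σ ρ : Perm) → (∀ a → to ρ a ≡ to π (to σ a)) →
              ∀ x → act ρ x ≡ act π (act σ x)
open PermSet public

Fix : List Atom → Perm → Set
Fix B π = ∀ b → b ∈ B → to π b ≡ b

module _ {ℓ} (X : PermSet ℓ) where
  Supports : List Atom → Carrier X → Set ℓ
  Supports B x = ∀ (π : Perm) → Fix B π → act X π x ≡ x

  StronglySupports : List Atom → Carrier X → Set ℓ
  StronglySupports B x = ∀ (π : Perm) → (Fix B π → act X π x ≡ x) × (act X π x ≡ x → Fix B π)

  IsNominal : Set ℓ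
  IsNominal = ∀ (x : Carrier X) → Σ (List Atom) λ B → Supports B x

  IsStrongNominal : Set ℓ
  IsStrongNominal = ∀ (x : Carrier X) → Σ (List Atom) λ B → StronglySupports B x

{-# OPTIONS --safe #-}
module Submission where

-- If B strongly supports x, the stabiliser of x is exactly Fix(B). Each γᵢ
-- fixes x, hence fixes B pointwise, so dom(γᵢ) misses B; since dom(π) is
-- covered by the dom(γᵢ), it misses B too, i.e. π ∈ Fix(B), and π fixes x.

open import Defs
open import Level using (Level)
open import Data.Nat using (ℕ)
open import Data.Nat.Properties using (_≟_)
open import Data.Fin using (Fin)
open import Data.List using (List)
open import Data.List.Membership.Propositional using (_∈_)
open import Data.Product using (Σ; _,_; proj₁; proj₂)
open import Data.Empty using (⊥-elim)
open import Relation.Nullary using (yes; no)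
open import Relation.Binary.PropositionalEquality using (_≡_)

Fix-dom-cover : ∀ {i} {I : Set i} (B : List Atom) (π : Perm) (γ : I → Perm) →
  (∀ j → Fix B (γ j)) →
  (∀ a → InDom π a → Σ I λ j → InDom (γ j) a) →
  Fix B π
Fix-dom-cover B π γ γ-fix dom⊆ b b∈B with to π b ≟ b
... | yes πb≡b = πb≡b
... | no b∈domπ with dom⊆ b b∈domπ
...   | j , b∈domγj = ⊥-elim (b∈domγj (γ-fix j b b∈B))

module _ {ℓ} (X : PermSet ℓ) {B : List Atom} {x : Carrier X}
         (B-strong : StronglySupports X B x) where

  stabiliser-dom-cover : ∀ {i} {I : Set i} (π : Perm) (γ : I → Perm) →
    (∀ j → act X (γ j) x ≡ x) →
    (∀ a → InDom π a → Σ I λ j → InDom (γ j) a) →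
    act X π x ≡ x
  stabiliser-dom-cover π γ γ-fix dom⊆ =
    proj₁ (B-strong π)
      (Fix-dom-cover B π γ (λ j → proj₂ (B-strong (γ j)) (γ-fix j)) dom⊆)

theorem3p4 : ∀ {ℓ : Level} (X : PermSet ℓ) → IsNominal X → IsStrongNominal X →
    (x : Carrier X) (π : Perm) (n : ℕ) (γ : Fin n → Perm) →
    (∀ i → act X (γ i) x ≡ x) →
    (∀ a → InDom π a → Σ (Fin n) λ i → InDom (γ i) a) →
    act X π x ≡ x
theorem3p4 X _ strong x π n γ =
  stabiliser-dom-cover X (proj₂ (strong x)) π γ
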